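{- Let $\lambda\in\mathbb{R}$ and let $p$ be a positive integer. Then \[ \Big(x\frac{d}{dx}\Big)_{p,\lambda}e^{x}=\sum_{n=1}^{\infty}\frac{(n)_{p,\lambda}}{n!}x^n=e^{x}\phi_{p,\lambda}(x). \]
   Context: For $\lambda\in\mathbb{R}$, the generalized falling factorials are $(x)_{0,\lambda}=1$ and $(x)_{n,\lambda}=x(x-\lambda)(x-2\lambda)\cdots(x-(n-1)\lambda)$ for $n\ge 1$. The degenerate differential operator is $\big(x\frac{d}{dx}\big)_{n,\lambda}=\big(x\frac{d}{dx}\big)\big(x\frac{d}{dx}-\lambda\big)\cdots\big(x\frac{d}{dx}-(n-1)\lambda\big)$ for $n\ge1$. The degenerate exponential is the formal power series $e_\lambda(t)=\sum_{n\ge 0}(1)_{n,\lambda}\frac{t^n}{n!}$. The degenerate Bell polynomials $\phi_{n,\lambda}(x)$ are defined by $e^{x(e_\lambda(t)-1)}=\sum_{n=0}^{\infty}\phi_{n,\lambda}(x)\frac{t^n}{n!}$ (as formal power series in $t$). -}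

module Defs where

open import Level using (Level)
open import Data.Nat using (ℕ; zero; suc; _∸_; _!)
open import Algebra.Bundles using (CommutativeRing)

-- Everything is parameterised by a commutative ring R (ℝ being the paper's case)
-- together with a function inv with the intended meaning inv n = 1/(n+1);
-- the law (n+1)·inv n ≈ 1 is a hypothesis of the theorem.
-- Formal power series in x over R are coefficient sequences ℕ → Carrier;
-- bivariate series in (t , x) are ℕ → ℕ → Carrier (t-degree first, x-degree second).
module Ops {c ℓ : Level} (R : CommutativeRing c ℓ) (inv : ℕ → CommutativeRing.Carrier R) where
  open CommutativeRing R

  natR : ℕ → Carrier
  natR zero    = 0#
  natR (suc n) = 1# + natR n

  invFact : ℕ → Carrier
  invFact zero    = 1#
  invFact (suc n) = inv n * invFact n

  sumTo : ℕ → (ℕ → Carrier) → Carrier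
  sumTo zero    g = g 0
  sumTo (suc n) g = sumTo n g + g (suc n)

  falling : Carrier → Carrier → ℕ → Carrier
  falling a lam zero    = 1#
  falling a lam (suc n) = falling a lam n * (a - natR n * lam)

  PS : Set c
  PS = ℕ → Carrier

  expX : PS
  expX m = invFact m

  mulPS : PS → PS → PS
  mulPS f g m = sumTo m (λ i → f i * g (m ∸ i))

  -- the operator (x d/dx - a) acting on formal power series: x^m ↦ (m - a) x^m
  xDminus : Carrier → PS → PS
  xDminus a f m = (natR m - a) * f m

  -- (x d/dx)_{n,λ} = (x d/dx)(x d/dx - λ)...(x d/dx - (n-1)λ)
  -- (rightmost factor applied first; for n = 0 the identity)
  degXD : Carrier → ℕ → PS → PS
  degXD lam zero    f = f
  degXD lam (suc n) f = degXD lam n (xDminus (natR n * lam) f)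

  PS2 : Set c
  PS2 = ℕ → ℕ → Carrier

  one2 : PS2
  one2 zero zero = 1#
  one2 _    _    = 0#

  mul2 : PS2 → PS2 → PS2
  mul2 F G n m = sumTo n (λ i → sumTo m (λ j → F i j * G (n ∸ i) (m ∸ j)))

  pow2 : PS2 → ℕ → PS2
  pow2 F zero    = one2
  pow2 F (suc k) = mul2 F (pow2 F k)

  -- exp(F) = Σ_k F^k / k! for F with zero constant term in t;
  -- the t^n coefficient only receives contributions from k ≤ n.
  exp2 : PS2 → PS2
  exp2 F n m = sumTo n (λ k → invFact k * pow2 F k n m)

  eLamCoeff : Carrier → ℕ → Carrier
  eLamCoeff lam n = falling 1# lam n * invFact n

  -- x (e_λ(t) - 1)
  xELamMinus1 : Carrier → PS2
  xELamMinus1 lam (suc n) (suc zero) = eLamCoeff lam (suc n)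
  xELamMinus1 lam _       _          = 0#

  degBell : Carrier → ℕ → PS
  degBell lam n m = natR (n !) * exp2 (xELamMinus1 lam) n m

  midSeries : Carrier → ℕ → PS
  midSeries lam p zero    = 0#
  midSeries lam p (suc n) = falling (natR (suc n)) lam p * invFact (suc n)

-- The operator x d/dx − a multiplies x^m by m − a, so (x d/dx)_{p,λ} e^x has coefficients
-- (m)_{p,λ}/m!.  For the Bell side, only the k-th power of x(e_λ(t) − 1) contributes to x^k,
-- so the x^m-coefficient of e^x φ_{p,λ}(x) is p! [t^p] Σ_{i+j=m} (e_λ(t) − 1)^j/(i! j!)
-- = (p!/m!) [t^p] e_λ(t)^m by the binomial theorem.  Finally e_λ(t)^s = Σ (s)_{n,λ} t^n/n!,
-- because both sides are the solution of (1 + λt) f′ = s f with f(0) = 1, and solutions of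
-- such equations multiply with the exponents adding.
module Submission where

open import Defs
open import Level using (Level)
open import Data.Nat using (ℕ; suc; _≤_)
open import Data.Product using (_×_)
open import Algebra.Bundles using (CommutativeRing)

open import Data.Nat as ℕ using (zero; z≤n; s≤s; _∸_; _!; _<_; _≤?_; _≟_)
import Data.Nat.Properties as ℕₚ
open import Data.Product using (_,_)
open import Function using (_∘_)
open import Relation.Binary.PropositionalEquality as ≡ using (_≡_; _≢_)
open import Relation.Nullary using (yes; no; contradiction)

module DegenerateBell {c ℓ : Level} (R : CommutativeRing c ℓ) (inv : ℕ → CommutativeRing.Carrier R) where
  open CommutativeRing R hiding (zero)
  open Ops R inv
  open import Relation.Binary.Reasoning.Setoid setoid
  open import Algebra.Solver.Ring.NaturalCoefficients.Default commutativeSemiring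
  open import Algebra.Properties.Ring ring using (-‿distribʳ-*)
  open import Algebra.Properties.AbelianGroup +-abelianGroup using (⁻¹-∙-comm)
  open import Algebra.Properties.CommutativeSemigroup *-commutativeSemigroup
    using (interchange; x∙yz≈y∙xz; x∙yz≈yx∙z)

  sumTo-cong : ∀ n {f g : ℕ → Carrier} → (∀ i → i ≤ n → f i ≈ g i) → sumTo n f ≈ sumTo n g
  sumTo-cong zero    f≈g = f≈g 0 z≤n
  sumTo-cong (suc n) f≈g =
    +-cong (sumTo-cong n (λ i i≤n → f≈g i (ℕₚ.m≤n⇒m≤1+n i≤n))) (f≈g (suc n) ℕₚ.≤-refl)

  sumTo-cong′ : ∀ n {f g : ℕ → Carrier} → (∀ i → f i ≈ g i) → sumTo n f ≈ sumTo n g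
  sumTo-cong′ n f≈g = sumTo-cong n (λ i _ → f≈g i)

  sumTo-zero : ∀ n {f : ℕ → Carrier} → (∀ i → i ≤ n → f i ≈ 0#) → sumTo n f ≈ 0#
  sumTo-zero zero    f≈0 = f≈0 0 z≤n
  sumTo-zero (suc n) f≈0 = trans
    (+-cong (sumTo-zero n (λ i i≤n → f≈0 i (ℕₚ.m≤n⇒m≤1+n i≤n))) (f≈0 (suc n) ℕₚ.≤-refl))
    (+-identityˡ 0#)

  sumTo-single : ∀ n {j} (f : ℕ → Carrier) → j ≤ n → (∀ i → i ≢ j → f i ≈ 0#) →
                 sumTo n f ≈ f j
  sumTo-single zero    f z≤n f≈0 = refl
  sumTo-single (suc n) {j} f j≤1+n f≈0 with j ≟ suc n
  ... | yes ≡.refl = trans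
    (+-cong (sumTo-zero n (λ i i≤n → f≈0 i (ℕₚ.<⇒≢ (s≤s i≤n)))) refl)
    (+-identityˡ _)
  ... | no j≢1+n = trans
    (+-cong (sumTo-single n f (ℕₚ.≤-pred (ℕₚ.≤∧≢⇒< j≤1+n j≢1+n)) f≈0)
            (f≈0 (suc n) (j≢1+n ∘ ≡.sym)))
    (+-identityʳ _)

  sumTo-+ : ∀ n (f g : ℕ → Carrier) → sumTo n (λ i → f i + g i) ≈ sumTo n f + sumTo n g
  sumTo-+ zero    f g = refl
  sumTo-+ (suc n) f g = begin
    sumTo n (λ i → f i + g i) + (f (suc n) + g (suc n))
      ≈⟨ +-cong (sumTo-+ n f g) refl ⟩
    (sumTo n f + sumTo n g) + (f (suc n) + g (suc n))
      ≈⟨ solve 4 (λ a b x y → (a :+ b) :+ (x :+ y) := (a :+ x) :+ (b :+ y)) refl _ _ _ _ ⟩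
    (sumTo n f + f (suc n)) + (sumTo n g + g (suc n)) ∎

  sumTo-*ˡ : ∀ n x (f : ℕ → Carrier) → x * sumTo n f ≈ sumTo n (λ i → x * f i)
  sumTo-*ˡ zero    x f = refl
  sumTo-*ˡ (suc n) x f = trans (distribˡ x _ _) (+-cong (sumTo-*ˡ n x f) refl)

  sumTo-suc : ∀ n (f : ℕ → Carrier) → sumTo (suc n) f ≈ f 0 + sumTo n (f ∘ suc)
  sumTo-suc zero    f = refl
  sumTo-suc (suc n) f = trans (+-cong (sumTo-suc n f) refl) (+-assoc _ _ _)

  sumTo-swap : ∀ m n (f : ℕ → ℕ → Carrier) →
               sumTo m (λ i → sumTo n (f i)) ≈ sumTo n (λ j → sumTo m (λ i → f i j))
  sumTo-swap zero    n f = refl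
  sumTo-swap (suc m) n f = trans (+-cong (sumTo-swap m n f) refl) (sym (sumTo-+ n _ _))

  natR-+ : ∀ m n → natR (m ℕ.+ n) ≈ natR m + natR n
  natR-+ zero    n = sym (+-identityˡ _)
  natR-+ (suc m) n = trans (+-cong refl (natR-+ m n)) (sym (+-assoc _ _ _))

  natR-* : ∀ m n → natR (m ℕ.* n) ≈ natR m * natR n
  natR-* zero    n = sym (zeroˡ _)
  natR-* (suc m) n = begin
    natR (n ℕ.+ m ℕ.* n)      ≈⟨ natR-+ n (m ℕ.* n) ⟩
    natR n + natR (m ℕ.* n)   ≈⟨ +-cong (sym (*-identityˡ _)) (natR-* m n) ⟩
    1# * natR n + natR m * natR n ≈⟨ sym (distribʳ _ _ _) ⟩
    (1# + natR m) * natR n    ∎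

  natR-∸ : ∀ {i n} → i ≤ n → natR n ≈ natR i + natR (n ∸ i)
  natR-∸ {i} i≤n = trans (reflexive (≡.cong natR (≡.sym (ℕₚ.m+[n∸m]≡n i≤n)))) (natR-+ i _)

  falling-0# : ∀ lam n → falling 0# lam (suc n) ≈ 0#
  falling-0# lam zero = begin
    1# * (0# - 0# * lam) ≈⟨ *-identityˡ _ ⟩
    0# - 0# * lam        ≈⟨ +-identityˡ _ ⟩
    - (0# * lam)         ≈⟨ -‿distribʳ-* 0# lam ⟩
    0# * - lam           ≈⟨ zeroˡ _ ⟩
    0#                   ∎
  falling-0# lam (suc n) = trans (*-cong (falling-0# lam n) refl) (zeroˡ _)

  onePS : PS
  onePS zero    = 1#
  onePS (suc _) = 0#

  powPS : PS → ℕ → PS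
  powPS f zero    = onePS
  powPS f (suc k) = mulPS f (powPS f k)

  deriv : PS → PS
  deriv f n = natR (suc n) * f (suc n)

  mulPS-congˡ : ∀ {f f′ : PS} → (∀ i → f i ≈ f′ i) → ∀ (g : PS) n → mulPS f g n ≈ mulPS f′ g n
  mulPS-congˡ f≈f′ g n = sumTo-cong′ n (λ i → *-cong (f≈f′ i) refl)

  mulPS-congʳ : ∀ (f : PS) {g g′ : PS} → (∀ i → g i ≈ g′ i) → ∀ n → mulPS f g n ≈ mulPS f g′ n
  mulPS-congʳ f g≈g′ n = sumTo-cong′ n (λ i → *-cong refl (g≈g′ (n ∸ i)))

  mulPS-identityˡ : ∀ (g : PS) n → mulPS onePS g n ≈ g n
  mulPS-identityˡ g zero    = *-identityˡ _
  mulPS-identityˡ g (suc n) = begin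
    mulPS onePS g (suc n)             ≈⟨ sumTo-suc n _ ⟩
    1# * g (suc n) + sumTo n (λ i → 0# * g (n ∸ i))
      ≈⟨ +-cong (*-identityˡ _) (sumTo-zero n (λ i _ → zeroˡ _)) ⟩
    g (suc n) + 0#                    ≈⟨ +-identityʳ _ ⟩
    g (suc n)                         ∎

  mulPS-distribˡ : ∀ (f g h : PS) n → mulPS f (λ i → g i + h i) n ≈ mulPS f g n + mulPS f h n
  mulPS-distribˡ f g h n = trans (sumTo-cong′ n (λ i → distribˡ _ _ _)) (sumTo-+ n _ _)

  mulPS-distribʳ : ∀ (f g h : PS) n → mulPS (λ i → f i + g i) h n ≈ mulPS f h n + mulPS g h n
  mulPS-distribʳ f g h n = trans (sumTo-cong′ n (λ i → distribʳ _ _ _)) (sumTo-+ n _ _)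

  mulPS-scaleʳ : ∀ (f g : PS) x n → mulPS f (λ i → x * g i) n ≈ x * mulPS f g n
  mulPS-scaleʳ f g x n = trans (sumTo-cong′ n (λ i → x∙yz≈y∙xz _ _ _)) (sym (sumTo-*ˡ n x _))

  mulPS-sumTo : ∀ m (f : PS) (u : ℕ → PS) n →
                mulPS f (λ k → sumTo m (λ i → u i k)) n ≈ sumTo m (λ i → mulPS f (u i) n)
  mulPS-sumTo m f u n =
    trans (sumTo-cong′ n (λ k → sumTo-*ˡ m (f k) _)) (sumTo-swap n m _)

  mulPS-onePlus : ∀ {e g : PS} → (∀ i → e i ≈ onePS i + g i) →
                  ∀ (h : PS) n → mulPS e h n ≈ h n + mulPS g h n
  mulPS-onePlus {e} {g} e≈1+g h n = begin
    mulPS e h n                         ≈⟨ mulPS-congˡ e≈1+g h n ⟩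
    mulPS (λ i → onePS i + g i) h n     ≈⟨ mulPS-distribʳ onePS g h n ⟩
    mulPS onePS h n + mulPS g h n       ≈⟨ +-cong (mulPS-identityˡ h n) refl ⟩
    h n + mulPS g h n                   ∎

  powPS-vanish : ∀ {g : PS} → g 0 ≈ 0# → ∀ k n → n < k → powPS g k n ≈ 0#
  powPS-vanish {g} g0≈0 (suc k) n (s≤s n≤k) = sumTo-zero n term
    where
    term : ∀ i → i ≤ n → g i * powPS g k (n ∸ i) ≈ 0#
    term zero    _ = trans (*-cong g0≈0 refl) (zeroˡ _)
    term (suc i) (s≤s {n = n′} i≤n′) = trans
      (*-cong refl (powPS-vanish g0≈0 k (n′ ∸ i) (ℕₚ.≤-<-trans (ℕₚ.m∸n≤m n′ i) n≤k)))
      (zeroʳ _)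

  deriv-mulPS : ∀ (f g : PS) n → deriv (mulPS f g) n ≈ mulPS (deriv f) g n + mulPS f (deriv g) n
  deriv-mulPS f g n = begin
    natR (suc n) * sumTo (suc n) (λ i → f i * g (suc n ∸ i))
      ≈⟨ sumTo-*ˡ (suc n) _ _ ⟩
    sumTo (suc n) (λ i → natR (suc n) * (f i * g (suc n ∸ i)))
      ≈⟨ sumTo-cong (suc n) (λ i i≤ → trans (*-cong (natR-∸ i≤) refl) (distribʳ _ _ _)) ⟩
    sumTo (suc n) (λ i → natR i * (f i * g (suc n ∸ i)) + natR (suc n ∸ i) * (f i * g (suc n ∸ i)))
      ≈⟨ sumTo-+ (suc n) _ _ ⟩
    sumTo (suc n) (λ i → natR i * (f i * g (suc n ∸ i)))
      + sumTo (suc n) (λ i → natR (suc n ∸ i) * (f i * g (suc n ∸ i)))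
      ≈⟨ +-cong differentiateLeft differentiateRight ⟩
    mulPS (deriv f) g n + mulPS f (deriv g) n ∎
    where
    differentiateLeft : sumTo (suc n) (λ i → natR i * (f i * g (suc n ∸ i))) ≈ mulPS (deriv f) g n
    differentiateLeft = begin
      sumTo (suc n) (λ i → natR i * (f i * g (suc n ∸ i)))   ≈⟨ sumTo-suc n _ ⟩
      0# * _ + sumTo n (λ i → natR (suc i) * (f (suc i) * g (n ∸ i)))
        ≈⟨ +-cong (zeroˡ _) (sumTo-cong′ n (λ i → sym (*-assoc _ _ _))) ⟩
      0# + mulPS (deriv f) g n                                ≈⟨ +-identityˡ _ ⟩
      mulPS (deriv f) g n                                     ∎

    shifted : ∀ {i} → i ≤ n → natR (suc n ∸ i) * (f i * g (suc n ∸ i)) ≈ f i * deriv g (n ∸ i)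
    shifted {i} i≤n rewrite ℕₚ.+-∸-assoc 1 i≤n = x∙yz≈y∙xz _ _ _

    differentiateRight : sumTo (suc n) (λ i → natR (suc n ∸ i) * (f i * g (suc n ∸ i)))
                         ≈ mulPS f (deriv g) n
    differentiateRight = begin
      sumTo n (λ i → natR (suc n ∸ i) * (f i * g (suc n ∸ i))) + natR (n ∸ n) * _
        ≈⟨ +-cong (sumTo-cong n (λ i → shifted))
                  (trans (*-cong (reflexive (≡.cong natR (ℕₚ.n∸n≡0 n))) refl) (zeroˡ _)) ⟩
      mulPS f (deriv g) n + 0#  ≈⟨ +-identityʳ _ ⟩
      mulPS f (deriv g) n       ∎

  degXD-coeff : ∀ lam p (f : PS) m → degXD lam p f m ≈ falling (natR m) lam p * f m
  degXD-coeff lam zero    f m = sym (*-identityˡ _)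
  degXD-coeff lam (suc p) f m =
    trans (degXD-coeff lam p (xDminus (natR p * lam) f) m) (sym (*-assoc _ _ _))

  midSeries-coeff : ∀ lam p → 1 ≤ p → ∀ m → midSeries lam p m ≈ falling (natR m) lam p * invFact m
  midSeries-coeff lam (suc p) _ zero    = sym (trans (*-cong (falling-0# lam p) refl) (zeroˡ _))
  midSeries-coeff lam (suc p) _ (suc m) = refl

  module _ (lam : Carrier) where

    eLamMinus1 : PS
    eLamMinus1 zero    = 0#
    eLamMinus1 (suc n) = eLamCoeff lam (suc n)

    eLamCoeff≈1+eLamMinus1 : ∀ i → eLamCoeff lam i ≈ onePS i + eLamMinus1 i
    eLamCoeff≈1+eLamMinus1 zero    = trans (*-identityˡ 1#) (sym (+-identityʳ 1#))
    eLamCoeff≈1+eLamMinus1 (suc i) = sym (+-identityˡ _)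

    xELamMinus1-x⁰ : ∀ i → xELamMinus1 lam i 0 ≡ 0#
    xELamMinus1-x⁰ zero    = ≡.refl
    xELamMinus1-x⁰ (suc i) = ≡.refl

    xELamMinus1-x¹ : ∀ i → xELamMinus1 lam i 1 ≡ eLamMinus1 i
    xELamMinus1-x¹ zero    = ≡.refl
    xELamMinus1-x¹ (suc i) = ≡.refl

    xELamMinus1-x²⁺ : ∀ i j → xELamMinus1 lam i (suc (suc j)) ≡ 0#
    xELamMinus1-x²⁺ zero    j = ≡.refl
    xELamMinus1-x²⁺ (suc i) j = ≡.refl

    mul2-xELamMinus1-x⁰ : ∀ (H : PS2) n → mul2 (xELamMinus1 lam) H n 0 ≈ 0#
    mul2-xELamMinus1-x⁰ H n =
      sumTo-zero n (λ i _ → trans (*-cong (reflexive (xELamMinus1-x⁰ i)) refl) (zeroˡ _))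

    mul2-xELamMinus1-xˢ : ∀ (H : PS2) n m →
                          mul2 (xELamMinus1 lam) H n (suc m) ≈ mulPS eLamMinus1 (λ i → H i m) n
    mul2-xELamMinus1-xˢ H n m = sumTo-cong′ n (λ i → begin
      sumTo (suc m) (λ j → xELamMinus1 lam i j * H (n ∸ i) (suc m ∸ j))
        ≈⟨ sumTo-suc m _ ⟩
      xELamMinus1 lam i 0 * _ + sumTo m (λ j → xELamMinus1 lam i (suc j) * H (n ∸ i) (m ∸ j))
        ≈⟨ +-cong (trans (*-cong (reflexive (xELamMinus1-x⁰ i)) refl) (zeroˡ _))
                  (sumTo-single m _ z≤n (higher i)) ⟩
      0# + xELamMinus1 lam i 1 * H (n ∸ i) m
        ≈⟨ trans (+-identityˡ _) (*-cong (reflexive (xELamMinus1-x¹ i)) refl) ⟩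
      eLamMinus1 i * H (n ∸ i) m ∎)
      where
      higher : ∀ i j → j ≢ 0 → xELamMinus1 lam i (suc j) * H (n ∸ i) (m ∸ j) ≈ 0#
      higher i zero    j≢0 = contradiction ≡.refl j≢0
      higher i (suc j) _   = trans (*-cong (reflexive (xELamMinus1-x²⁺ i j)) refl) (zeroˡ _)

    pow2-xELamMinus1-diagonal : ∀ k n → pow2 (xELamMinus1 lam) k n k ≈ powPS eLamMinus1 k n
    pow2-xELamMinus1-diagonal zero zero    = refl
    pow2-xELamMinus1-diagonal zero (suc n) = refl
    pow2-xELamMinus1-diagonal (suc k) n    = trans (mul2-xELamMinus1-xˢ (pow2 (xELamMinus1 lam) k) n k)
      (mulPS-congʳ eLamMinus1 (λ i → pow2-xELamMinus1-diagonal k i) n)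

    pow2-xELamMinus1-offDiagonal : ∀ k n m → k ≢ m → pow2 (xELamMinus1 lam) k n m ≈ 0#
    pow2-xELamMinus1-offDiagonal zero    n       zero    k≢m = contradiction ≡.refl k≢m
    pow2-xELamMinus1-offDiagonal zero    zero    (suc m) _   = refl
    pow2-xELamMinus1-offDiagonal zero    (suc n) (suc m) _   = refl
    pow2-xELamMinus1-offDiagonal (suc k) n       zero    _   = mul2-xELamMinus1-x⁰ (pow2 (xELamMinus1 lam) k) n
    pow2-xELamMinus1-offDiagonal (suc k) n       (suc m) k≢m =
      trans (mul2-xELamMinus1-xˢ (pow2 (xELamMinus1 lam) k) n m)
      (sumTo-zero n (λ i _ → trans
        (*-cong refl (pow2-xELamMinus1-offDiagonal k (n ∸ i) m (k≢m ∘ ≡.cong suc))) (zeroʳ _)))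

    exp2-xELamMinus1 : ∀ n m → exp2 (xELamMinus1 lam) n m ≈ invFact m * powPS eLamMinus1 m n
    exp2-xELamMinus1 n m with m ≤? n
    ... | yes m≤n = trans
      (sumTo-single n _ m≤n (λ k k≢m →
        trans (*-cong refl (pow2-xELamMinus1-offDiagonal k n m k≢m)) (zeroʳ _)))
      (*-cong refl (pow2-xELamMinus1-diagonal m n))
    ... | no m≰n = trans
      (sumTo-zero n (λ k k≤n → trans
        (*-cong refl (pow2-xELamMinus1-offDiagonal k n m (ℕₚ.<⇒≢ (ℕₚ.≤-<-trans k≤n n<m))))
        (zeroʳ _)))
      (sym (trans (*-cong refl (powPS-vanish refl m n n<m)) (zeroʳ _)))
      where
      n<m : n < m
      n<m = ℕₚ.≰⇒> m≰n

  module _ (natR*inv≈1 : ∀ n → natR (suc n) * inv n ≈ 1#) where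

    inv-cancelˡ : ∀ n x → inv n * (natR (suc n) * x) ≈ x
    inv-cancelˡ n x = begin
      inv n * (natR (suc n) * x) ≈⟨ x∙yz≈yx∙z _ _ _ ⟩
      (natR (suc n) * inv n) * x ≈⟨ *-cong (natR*inv≈1 n) refl ⟩
      1# * x                     ≈⟨ *-identityˡ x ⟩
      x                          ∎

    natR-cancelˡ : ∀ n x → natR (suc n) * (inv n * x) ≈ x
    natR-cancelˡ n x = trans (sym (*-assoc _ _ _)) (trans (*-cong (natR*inv≈1 n) refl) (*-identityˡ x))

    natR-!*invFact : ∀ n → natR (n !) * invFact n ≈ 1#
    natR-!*invFact zero    = trans (*-cong (+-identityʳ 1#) refl) (*-identityˡ 1#)
    natR-!*invFact (suc n) = begin
      natR (suc n ℕ.* n !) * (inv n * invFact n)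
        ≈⟨ *-cong (natR-* (suc n) (n !)) refl ⟩
      (natR (suc n) * natR (n !)) * (inv n * invFact n)  ≈⟨ interchange _ _ _ _ ⟩
      (natR (suc n) * inv n) * (natR (n !) * invFact n)
        ≈⟨ *-cong (natR*inv≈1 n) (natR-!*invFact n) ⟩
      1# * 1#                                            ≈⟨ *-identityˡ 1# ⟩
      1#                                                 ∎

    deriv-expX : ∀ n → deriv expX n ≈ expX n
    deriv-expX n = natR-cancelˡ n (invFact n)

    binomial : ∀ {e g : PS} → (∀ i → e i ≈ onePS i + g i) →
               ∀ m n → mulPS expX (λ j → invFact j * powPS g j n) m ≈ invFact m * powPS e m n
    binomial {e} {g} e≈1+g zero    n = *-identityˡ _
    binomial {e} {g} e≈1+g (suc m) n = begin
      B (suc m) n                                 ≈⟨ sym (inv-cancelˡ m _) ⟩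
      inv m * deriv (λ j → B j n) m               ≈⟨ *-cong refl step ⟩
      inv m * mulPS e (B m) n                     ≈⟨ *-cong refl (mulPS-congʳ e (binomial e≈1+g m) n) ⟩
      inv m * mulPS e (λ k → invFact m * powPS e m k) n
        ≈⟨ *-cong refl (mulPS-scaleʳ e (powPS e m) _ n) ⟩
      inv m * (invFact m * powPS e (suc m) n)     ≈⟨ sym (*-assoc _ _ _) ⟩
      invFact (suc m) * powPS e (suc m) n         ∎
      where
      B : ℕ → ℕ → Carrier
      B m n = mulPS expX (λ j → invFact j * powPS g j n) m

      -- In the variable m, B is the product of e^x and Σ_j g^j x^j/j!, whose derivative
      -- is g times itself; so the Leibniz rule gives (m + 1) B_{m+1} = e B_m.
      step : deriv (λ j → B j n) m ≈ mulPS e (B m) n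
      step = begin
        deriv (mulPS expX expG) m
          ≈⟨ deriv-mulPS expX expG m ⟩
        mulPS (deriv expX) expG m + mulPS expX (deriv expG) m
          ≈⟨ +-cong (mulPS-congˡ deriv-expX expG m) (mulPS-congʳ expX deriv-expG m) ⟩
        mulPS expX expG m + mulPS expX expG′ m
          ≈⟨ sym (mulPS-distribˡ expX expG expG′ m) ⟩
        mulPS expX (λ j → expG j + expG′ j) m
          ≈⟨ mulPS-congʳ expX (λ j → trans (sym (distribˡ (invFact j) (powPS g j n) (powPS g (suc j) n)))
                                            (*-cong refl (sym (mulPS-onePlus e≈1+g (powPS g j) n)))) m ⟩
        sumTo m (λ i → invFact i * (invFact (m ∸ i) * mulPS e (powPS g (m ∸ i)) n))
          ≈⟨ sumTo-cong′ m (λ i → sym (mulPS-summand i)) ⟩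
        sumTo m (λ i → mulPS e (summand i) n)
          ≈⟨ sym (mulPS-sumTo m e summand n) ⟩
        mulPS e (B m) n ∎
        where
        expG : PS
        expG j = invFact j * powPS g j n

        expG′ : PS
        expG′ j = invFact j * powPS g (suc j) n

        deriv-expG : ∀ j → deriv expG j ≈ expG′ j
        deriv-expG j = trans (*-cong refl (*-assoc _ _ _)) (natR-cancelˡ j _)

        summand : ℕ → PS
        summand i k = invFact i * (invFact (m ∸ i) * powPS g (m ∸ i) k)

        mulPS-summand : ∀ i → mulPS e (summand i) n
                              ≈ invFact i * (invFact (m ∸ i) * mulPS e (powPS g (m ∸ i)) n)
        mulPS-summand i = trans (mulPS-scaleʳ e (λ k → invFact (m ∸ i) * powPS g (m ∸ i) k) (invFact i) n)
                                (*-cong refl (mulPS-scaleʳ e (powPS g (m ∸ i)) (invFact (m ∸ i)) n))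

    module _ (lam : Carrier) where

      -- (1 + λt) f′ = s f, read off coefficientwise
      DegExpODE : Carrier → PS → Set ℓ
      DegExpODE s f = ∀ n → deriv f n ≈ (s - natR n * lam) * f n

      degExpPow : Carrier → PS
      degExpPow s n = falling s lam n * invFact n

      degExpPow-ode : ∀ s → DegExpODE s (degExpPow s)
      degExpPow-ode s n = begin
        natR (suc n) * ((falling s lam n * (s - natR n * lam)) * (inv n * invFact n))
          ≈⟨ solve 5 (λ N f d i g → N :* ((f :* d) :* (i :* g)) := N :* (i :* (d :* (f :* g))))
                     refl _ _ _ _ _ ⟩
        natR (suc n) * (inv n * ((s - natR n * lam) * (falling s lam n * invFact n)))
          ≈⟨ natR-cancelˡ n _ ⟩
        (s - natR n * lam) * degExpPow s n ∎

      DegExpODE-unique : ∀ {s f g} → DegExpODE s f → DegExpODE s g → f 0 ≈ g 0 → ∀ n → f n ≈ g n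
      DegExpODE-unique hf hg f0≈g0 zero    = f0≈g0
      DegExpODE-unique {s} {f} {g} hf hg f0≈g0 (suc n) = begin
        f (suc n)                          ≈⟨ sym (inv-cancelˡ n _) ⟩
        inv n * deriv f n                  ≈⟨ *-cong refl (hf n) ⟩
        inv n * ((s - natR n * lam) * f n) ≈⟨ *-cong refl (*-cong refl (DegExpODE-unique hf hg f0≈g0 n)) ⟩
        inv n * ((s - natR n * lam) * g n) ≈⟨ *-cong refl (sym (hg n)) ⟩
        inv n * deriv g n                  ≈⟨ inv-cancelˡ n _ ⟩
        g (suc n)                          ∎

      exponents-add : ∀ a b x y z → x + y ≈ z → (a - x * lam) + (b - y * lam) ≈ (a + b) - z * lam
      exponents-add a b x y z x+y≈z = begin
        (a - x * lam) + (b - y * lam)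
          ≈⟨ solve 4 (λ p q r s → (p :+ r) :+ (q :+ s) := (p :+ q) :+ (r :+ s)) refl a b _ _ ⟩
        (a + b) + (- (x * lam) + - (y * lam)) ≈⟨ +-cong refl (⁻¹-∙-comm _ _) ⟩
        (a + b) - (x * lam + y * lam)         ≈⟨ +-cong refl (-‿cong (sym (distribʳ lam x y))) ⟩
        (a + b) - (x + y) * lam               ≈⟨ +-cong refl (-‿cong (*-cong x+y≈z refl)) ⟩
        (a + b) - z * lam                     ∎

      DegExpODE-mulPS : ∀ {a b f g} → DegExpODE a f → DegExpODE b g → DegExpODE (a + b) (mulPS f g)
      DegExpODE-mulPS {a} {b} {f} {g} hf hg n = begin
        deriv (mulPS f g) n
          ≈⟨ deriv-mulPS f g n ⟩
        mulPS (deriv f) g n + mulPS f (deriv g) n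
          ≈⟨ +-cong (mulPS-congˡ hf g n) (mulPS-congʳ f hg n) ⟩
        sumTo n (λ i → (a - natR i * lam) * f i * g (n ∸ i))
          + sumTo n (λ i → f i * ((b - natR (n ∸ i) * lam) * g (n ∸ i)))
          ≈⟨ sym (sumTo-+ n _ _) ⟩
        sumTo n (λ i → (a - natR i * lam) * f i * g (n ∸ i) + f i * ((b - natR (n ∸ i) * lam) * g (n ∸ i)))
          ≈⟨ sumTo-cong n (λ i i≤n → trans
               (solve 4 (λ A B F G → A :* F :* G :+ F :* (B :* G) := (A :+ B) :* (F :* G)) refl _ _ _ _)
               (*-cong (exponents-add a b _ _ _ (sym (natR-∸ i≤n))) refl)) ⟩
        sumTo n (λ i → ((a + b) - natR n * lam) * (f i * g (n ∸ i)))
          ≈⟨ sym (sumTo-*ˡ n _ _) ⟩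
        ((a + b) - natR n * lam) * mulPS f g n ∎

      degExpPow-+ : ∀ a b n → mulPS (degExpPow a) (degExpPow b) n ≈ degExpPow (a + b) n
      degExpPow-+ a b = DegExpODE-unique
        (DegExpODE-mulPS (degExpPow-ode a) (degExpPow-ode b)) (degExpPow-ode (a + b))
        (*-cong (*-identityˡ 1#) (*-identityˡ 1#))

      powPS-eLamCoeff : ∀ m n → powPS (eLamCoeff lam) m n ≈ degExpPow (natR m) n
      powPS-eLamCoeff zero zero    = sym (*-identityˡ 1#)
      powPS-eLamCoeff zero (suc n) = sym (trans (*-cong (falling-0# lam n) refl) (zeroˡ _))
      powPS-eLamCoeff (suc m) n    =
        trans (mulPS-congʳ (eLamCoeff lam) (powPS-eLamCoeff m) n) (degExpPow-+ 1# (natR m) n)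

      expX*degBell : ∀ p m → mulPS expX (degBell lam p) m ≈ falling (natR m) lam p * invFact m
      expX*degBell p m = begin
        mulPS expX (degBell lam p) m
          ≈⟨ mulPS-congʳ expX (λ j → *-cong (refl {natR (p !)}) (exp2-xELamMinus1 lam p j)) m ⟩
        mulPS expX (λ j → natR (p !) * (invFact j * powPS (eLamMinus1 lam) j p)) m
          ≈⟨ mulPS-scaleʳ expX (λ j → invFact j * powPS (eLamMinus1 lam) j p) (natR (p !)) m ⟩
        natR (p !) * mulPS expX (λ j → invFact j * powPS (eLamMinus1 lam) j p) m
          ≈⟨ *-cong refl (binomial (eLamCoeff≈1+eLamMinus1 lam) m p) ⟩
        natR (p !) * (invFact m * powPS (eLamCoeff lam) m p)
          ≈⟨ *-cong refl (*-cong refl (powPS-eLamCoeff m p)) ⟩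
        natR (p !) * (invFact m * (falling (natR m) lam p * invFact p))
          ≈⟨ solve 4 (λ N i f j → N :* (i :* (f :* j)) := (N :* j) :* (f :* i)) refl _ _ _ _ ⟩
        (natR (p !) * invFact p) * (falling (natR m) lam p * invFact m)
          ≈⟨ trans (*-cong (natR-!*invFact p) refl) (*-identityˡ _) ⟩
        falling (natR m) lam p * invFact m ∎

theorem5 : {c ℓ : Level} (R : CommutativeRing c ℓ)
           (inv : ℕ → CommutativeRing.Carrier R) →
           (∀ n → CommutativeRing._≈_ R (CommutativeRing._*_ R (Ops.natR R inv (suc n)) (inv n)) (CommutativeRing.1# R)) →
           (lam : CommutativeRing.Carrier R) (p : ℕ) → 1 ≤ p →
           ∀ m →
             CommutativeRing._≈_ R (Ops.degXD R inv lam p (Ops.expX R inv) m) (Ops.midSeries R inv lam p m)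
             × CommutativeRing._≈_ R (Ops.midSeries R inv lam p m) (Ops.mulPS R inv (Ops.expX R inv) (Ops.degBell R inv lam p) m)
theorem5 R inv natR*inv≈1 lam p 1≤p m =
    trans (degXD-coeff lam p expX m) (sym midSeries≈)
  , trans midSeries≈ (sym (expX*degBell natR*inv≈1 lam p m))
  where
  open CommutativeRing R
  open Ops R inv
  open DegenerateBell R inv

  midSeries≈ : midSeries lam p m ≈ falling (natR m) lam p * invFact m
  midSeries≈ = midSeries-coeff lam p 1≤p m
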